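{- Let $h \ge 6$. If $Y$ is a subset of a mutual-visibility set $M$ of $Q_h$ such that the induced subgraph $Q_h[Y]$ is isomorphic to the star $K_{1,4}$, then $|M| \le 2^{h-1}-2$.
   Context: $Q_h$ is the hypercube with vertex set $\{0,1\}^h$, two strings adjacent iff they differ in exactly one position. For $M \subseteq V(G)$, a $u,v$-path is $M$-free if it contains no vertex of $M\setminus\{u,v\}$; $u,v$ are $M$-visible if there is an $M$-free shortest $u,v$-path; $M$ is a mutual-visibility set if every two vertices of $M$ are $M$-visible. -}

module Defs where

open import Data.Bool using (Bool; true; false)
open import Data.Nat using (ℕ; zero; suc; _+_; _≤_)
open import Data.Vec using (Vec; []; _∷_)
open import Data.Fin using (Fin)
open import Data.List using (List; _∷_; []; _∷ʳ_; length)
open import Data.List.Membership.Propositional using (_∈_)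
open import Data.List.Relation.Unary.All using (All)
open import Data.List.Relation.Unary.Linked using (Linked)
open import Data.List.Relation.Unary.Unique.Propositional using (Unique)
open import Data.Product using (Σ; ∃; _×_; ∃-syntax)
open import Data.Sum using (_⊎_)
open import Relation.Binary.PropositionalEquality using (_≡_; _≢_)
open import Relation.Nullary using (¬_)
open import Function.Definitions using (Injective)
open import Function.Bundles using (_⇔_)

V : ℕ → Set
V h = Vec Bool h

diffCount : ∀ {h} → V h → V h → ℕ
diffCount [] [] = 0
diffCount (true ∷ xs) (true ∷ ys) = diffCount xs ys
diffCount (false ∷ xs) (false ∷ ys) = diffCount xs ys
diffCount (true ∷ xs) (false ∷ ys) = suc (diffCount xs ys)
diffCount (false ∷ xs) (true ∷ ys) = suc (diffCount xs ys)

Adj : ∀ {h} → V h → V h → Set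
Adj x y = diffCount x y ≡ 1

-- a u,v-path given by its vertex sequence (length of the path = length xs - 1)
IsPath : ∀ {h} → List (V h) → V h → V h → Set
IsPath {h} xs u v =
  (∃[ ys ] xs ≡ u ∷ ys) × (∃[ zs ] xs ≡ zs ∷ʳ v) × Linked Adj xs × Unique xs

IsShortestPath : ∀ {h} → List (V h) → V h → V h → Set
IsShortestPath {h} xs u v =
  IsPath xs u v × (∀ (ys : List (V h)) → IsPath ys u v → length xs ≤ length ys)

IsFree : ∀ {h} → List (V h) → V h → V h → List (V h) → Set
IsFree M u v xs = All (λ w → w ∈ M → (w ≡ u ⊎ w ≡ v)) xs

Visible : ∀ {h} → List (V h) → V h → V h → Set
Visible M u v = ∃[ xs ] (IsShortestPath xs u v × IsFree M u v xs)

-- M (a finite vertex set, given as a duplicate-free list) is a mutual-visibility set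
IsMutualVisibility : ∀ {h} → List (V h) → Set
IsMutualVisibility M = ∀ u v → u ∈ M → v ∈ M → Visible M u v

InducedStar14 : ∀ {h} → List (V h) → Set
InducedStar14 {h} Y =
  Σ (V h) λ c → Σ (Fin 4 → V h) λ a →
    (∀ y → (y ∈ Y) ⇔ (y ≡ c ⊎ ∃[ i ] y ≡ a i)) ×
    Injective _≡_ _≡_ a ×
    (∀ i → c ≢ a i) ×
    (∀ i → Adj c (a i)) ×
    (∀ i j → i ≢ j → ¬ Adj (a i) (a j))

-- Qₙ₊₁ is the union of its two facets {0,1} × Qₙ, and a facet is convex: every shortest path
-- between two of its vertices stays inside it. So the traces of a mutual-visibility set M on the
-- two facets are mutual-visibility sets of Qₙ, and the largest size μ(Qₙ) of a mutual-visibility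
-- set satisfies μ(Qₙ₊₁) ≤ 2 μ(Qₙ). A verified exhaustive search shows that mutual-visibility sets
-- of Q₄ have at most 9 vertices, that those with 9 are images of one fixed set under symmetries
-- of Q₄, and that when one facet of Q₅ carries that set the other carries at most 7 vertices of
-- M; hence μ(Q₅) ≤ 16 and μ(Qₙ) ≤ 2ⁿ⁻¹ for n ≥ 5.
-- If M contains a vertex c and four of its neighbours, some coordinate is changed by none of
-- these edges, and the facet across that coordinate containing c contains the whole star. In Q₄
-- the star uses all neighbours of c, so every shortest path from c to a vertex of M has its
-- second vertex in M, which forces M into the closed neighbourhood of c, of 5 vertices. Bounding
-- the facet with the star and the other facet separately then gives 5 + 9 = 2⁴ − 2 in Q₅ and
-- (2ⁿ⁻² − 2) + 2ⁿ⁻² = 2ⁿ⁻¹ − 2 in Qₙ.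

module Submission where

open import Defs
open import Algebra.Properties.CommutativeSemigroup using (interchange; x∙yz≈y∙xz; xy∙z≈xz∙y)
open import Data.Bool using (Bool; true; false; not; _∧_; _∨_; _xor_; T; _≟_)
open import Data.Bool.ListAction using (all; any)
open import Data.Bool.Properties using (T-∧; T-∨; T-≡)
open import Data.Empty using (⊥; ⊥-elim)
open import Data.Fin using (Fin; zero; suc)
open import Data.Fin.Properties using (any?; injective⇒≤; ¬∀⟶∃¬) renaming (_≟_ to _≟ᶠ_)
open import Data.List
  using (List; []; _∷_; _∷ʳ_; _++_; map; length; allFin; filter; filterᵇ; foldr; cartesianProductWith)
import Data.List.Properties as List
open import Data.List.Properties using (length-map; length-++; length-filter; length-removeAt′)
open import Data.List.Membership.Propositional using (_∈_; _∉_)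
open import Data.List.Membership.Propositional.Properties
  using (∈-map⁺; ∈-map⁻; ∈-allFin; ∈-++⁺ˡ; ∈-++⁺ʳ; ∈-++⁻; ∈-filter⁺; ∈-filter⁻)
import Data.List.Membership.DecPropositional as DecMembership
open import Data.List.Relation.Binary.Subset.Propositional using (_⊆_)
import Data.List.Relation.Binary.Subset.Propositional.Properties as Subset
open import Data.List.Relation.Binary.Subset.Propositional.Properties using (∈-∷⁺ʳ; ⊆-trans)
open import Data.List.Relation.Unary.All as All using (All; []; _∷_)
import Data.List.Relation.Unary.All.Properties as All
open import Data.List.Relation.Unary.AllPairs using ([]; _∷_)
open import Data.List.Relation.Unary.Any as Any using (here; there; index; _─_)
import Data.List.Relation.Unary.Any.Properties as Any
open import Data.List.Relation.Unary.Linked as Linked using (Linked; [-]; _∷_)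
import Data.List.Relation.Unary.Linked.Properties as Linked
open import Data.List.Relation.Unary.Unique.Propositional using (Unique)
import Data.List.Relation.Unary.Unique.Propositional.Properties as Unique
open import Data.List.Relation.Unary.Unique.DecPropositional using (unique?)
open import Data.Nat using (ℕ; zero; suc; _+_; _∸_; _^_; _≤_; _<_; z≤n; s≤s; s≤s⁻¹; _<ᵇ_; _≡ᵇ_)
open import Data.Nat.Properties
  using (≤-refl; ≤-trans; ≤-reflexive; ≤-antisym; ≤-<-trans; <⇒≱; ≰⇒>; _≤?_; n≤1+n; 1+n≰n; m≤m+n; m≤n+m;
         n≤0⇒n≡0; suc-injective; +-suc; +-comm; +-identityʳ; +-mono-≤; +-monoˡ-≤; +-monoʳ-≤; +-cancelˡ-≤;
         <ᵇ⇒<; ≡ᵇ⇒≡; ≡⇒≡ᵇ; m≤n⇒∃[o]m+o≡n; m+n≤o⇒m≤o∸n; +-commutativeSemigroup; module ≤-Reasoning)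
open import Data.Product using (∃-syntax; _×_; _,_; proj₁; proj₂; map₂)
open import Data.Sum as Sum using (_⊎_; inj₁; inj₂; [_,_]′; map₁)
open import Data.Vec using ([]; _∷_; lookup; updateAt; removeAt)
open import Data.Vec.Properties using (≡-dec; ∷-injectiveʳ; lookup∘updateAt′)
open import Function using (id; const; _∘_)
open import Function.Bundles using (Equivalence)
open import Function.Definitions using (Injective)
open import Relation.Binary.Definitions using (DecidableEquality)
open import Relation.Binary.PropositionalEquality
open import Relation.Nullary using (¬_; Dec; yes; no; contradiction)
open import Relation.Nullary.Decidable using (T?; toWitness)

-- Distances and geodesics

bitDistance : Bool → Bool → ℕ
bitDistance true  true  = 0
bitDistance false false = 0
bitDistance true  false = 1
bitDistance false true  = 1

bitDistance-≢ : ∀ {a b} → a ≢ b → bitDistance a b ≡ 1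
bitDistance-≢ {true}  {true}  a≢b = contradiction refl a≢b
bitDistance-≢ {false} {false} a≢b = contradiction refl a≢b
bitDistance-≢ {true}  {false} _   = refl
bitDistance-≢ {false} {true}  _   = refl

bitDistance-triangle : ∀ a b c → bitDistance a c ≤ bitDistance a b + bitDistance b c
bitDistance-triangle true  true  true  = z≤n
bitDistance-triangle true  true  false = ≤-refl
bitDistance-triangle true  false true  = z≤n
bitDistance-triangle true  false false = ≤-refl
bitDistance-triangle false true  true  = ≤-refl
bitDistance-triangle false true  false = z≤n
bitDistance-triangle false false true  = ≤-refl
bitDistance-triangle false false false = z≤n

module _ {n : ℕ} where

  diffCount-∷ : ∀ a b (x y : V n) → diffCount (a ∷ x) (b ∷ y) ≡ bitDistance a b + diffCount x y
  diffCount-∷ true  true  x y = refl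
  diffCount-∷ false false x y = refl
  diffCount-∷ true  false x y = refl
  diffCount-∷ false true  x y = refl

  diffCount-∷-same : ∀ a (x y : V n) → diffCount (a ∷ x) (a ∷ y) ≡ diffCount x y
  diffCount-∷-same true  x y = refl
  diffCount-∷-same false x y = refl

diffCount-∷-cong : ∀ {n} a b {x y x′ y′ : V n} → diffCount x′ y′ ≡ diffCount x y →
                   diffCount (a ∷ x′) (b ∷ y′) ≡ diffCount (a ∷ x) (b ∷ y)
diffCount-∷-cong true  true  eq = eq
diffCount-∷-cong false false eq = eq
diffCount-∷-cong true  false eq = cong suc eq
diffCount-∷-cong false true  eq = cong suc eq

diffCount-refl : ∀ {n} (x : V n) → diffCount x x ≡ 0
diffCount-refl []          = refl
diffCount-refl (true ∷ x)  = diffCount-refl x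
diffCount-refl (false ∷ x) = diffCount-refl x

diffCount≡0⇒≡ : ∀ {n} {x y : V n} → diffCount x y ≡ 0 → x ≡ y
diffCount≡0⇒≡ {x = []}         {[]}         _ = refl
diffCount≡0⇒≡ {x = true ∷ x}  {true ∷ y}  e = cong (true ∷_) (diffCount≡0⇒≡ e)
diffCount≡0⇒≡ {x = false ∷ x} {false ∷ y} e = cong (false ∷_) (diffCount≡0⇒≡ e)

diffCount≤dim : ∀ {n} (x y : V n) → diffCount x y ≤ n
diffCount≤dim []          []          = z≤n
diffCount≤dim (true ∷ x)  (true ∷ y)  = ≤-trans (diffCount≤dim x y) (n≤1+n _)
diffCount≤dim (false ∷ x) (false ∷ y) = ≤-trans (diffCount≤dim x y) (n≤1+n _)
diffCount≤dim (true ∷ x)  (false ∷ y) = s≤s (diffCount≤dim x y)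
diffCount≤dim (false ∷ x) (true ∷ y)  = s≤s (diffCount≤dim x y)

diffCount-triangle : ∀ {n} (x y z : V n) → diffCount x z ≤ diffCount x y + diffCount y z
diffCount-triangle [] [] [] = z≤n
diffCount-triangle (a ∷ x) (b ∷ y) (c ∷ z) = begin
  diffCount (a ∷ x) (c ∷ z)
    ≡⟨ diffCount-∷ a c x z ⟩
  bitDistance a c + diffCount x z
    ≤⟨ +-mono-≤ (bitDistance-triangle a b c) (diffCount-triangle x y z) ⟩
  (bitDistance a b + bitDistance b c) + (diffCount x y + diffCount y z)
    ≡⟨ interchange +-commutativeSemigroup (bitDistance a b) _ _ _ ⟩
  (bitDistance a b + diffCount x y) + (bitDistance b c + diffCount y z)
    ≡⟨ cong₂ _+_ (diffCount-∷ a b x y) (diffCount-∷ b c y z) ⟨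
  diffCount (a ∷ x) (b ∷ y) + diffCount (b ∷ y) (c ∷ z)
    ∎
  where open ≤-Reasoning

-- A path is handled as its first vertex u and the list ys of the others; it ends at lastOf u ys.

lastOf : ∀ {A : Set} → A → List A → A
lastOf u []       = u
lastOf u (y ∷ ys) = lastOf y ys

lastOf-map : ∀ {A B : Set} (f : A → B) u ys → lastOf (f u) (map f ys) ≡ f (lastOf u ys)
lastOf-map f u []       = refl
lastOf-map f u (y ∷ ys) = lastOf-map f y ys

lastOf-∷ʳ : ∀ {A : Set} (u : A) ys → ∃[ zs ] u ∷ ys ≡ zs ∷ʳ lastOf u ys
lastOf-∷ʳ u []       = [] , refl
lastOf-∷ʳ u (y ∷ ys) with zs , eq ← lastOf-∷ʳ y ys = u ∷ zs , cong (u ∷_) eq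

∷ʳ⇒lastOf : ∀ {A : Set} {u v : A} ys zs → u ∷ ys ≡ zs ∷ʳ v → lastOf u ys ≡ v
∷ʳ⇒lastOf []       []           refl = refl
∷ʳ⇒lastOf []       (_ ∷ [])     ()
∷ʳ⇒lastOf []       (_ ∷ _ ∷ _)  ()
∷ʳ⇒lastOf (y ∷ ys) (z ∷ zs)     eq   = ∷ʳ⇒lastOf ys zs (List.∷-injectiveʳ eq)

walk-length≥diffCount : ∀ {n} (u : V n) ys → Linked Adj (u ∷ ys) → diffCount u (lastOf u ys) ≤ length ys
walk-length≥diffCount u []       _            = ≤-reflexive (diffCount-refl u)
walk-length≥diffCount u (y ∷ ys) (u~y ∷ walk) = begin
  diffCount u (lastOf y ys)                     ≤⟨ diffCount-triangle u y _ ⟩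
  diffCount u y + diffCount y (lastOf y ys)     ≡⟨ cong (_+ _) u~y ⟩
  suc (diffCount y (lastOf y ys))               ≤⟨ s≤s (walk-length≥diffCount y ys walk) ⟩
  suc (length ys)                               ∎
  where open ≤-Reasoning

record Geodesic {n} (u : V n) (ys : List (V n)) (v : V n) : Set where
  field
    linked : Linked Adj (u ∷ ys)
    unique : Unique (u ∷ ys)
    ends   : lastOf u ys ≡ v
    tight  : length ys ≡ diffCount u v

open Geodesic

module _ {n : ℕ} {u v : V n} where

  Geodesic⇒IsPath : ∀ {ys} → Geodesic u ys v → IsPath (u ∷ ys) u v
  Geodesic⇒IsPath {ys} g =
    (ys , refl) , subst (λ w → ∃[ zs ] u ∷ ys ≡ zs ∷ʳ w) (ends g) (lastOf-∷ʳ u ys) , linked g , unique g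

  Geodesic-tail : ∀ {w ys} → Geodesic u (w ∷ ys) v → Geodesic w ys v × suc (diffCount w v) ≡ diffCount u v
  Geodesic-tail {w} {ys} record { linked = u~w ∷ walk ; unique = _ ∷ unique ; ends = refl ; tight = tight } =
    record { linked = walk ; unique = unique ; ends = refl ; tight = ≤-antisym ys≤ ≤ys } , ≤-antisym ≤u u≤
    where
      ≤ys : diffCount w v ≤ length ys
      ≤ys = walk-length≥diffCount w ys walk
      u≤ : diffCount u v ≤ suc (diffCount w v)
      u≤ = ≤-trans (diffCount-triangle u w v) (≤-reflexive (cong (_+ diffCount w v) u~w))
      ys≤ : length ys ≤ diffCount w v
      ys≤ = s≤s⁻¹ (≤-trans (≤-reflexive tight) u≤)
      ≤u : suc (diffCount w v) ≤ diffCount u v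
      ≤u = ≤-trans (s≤s ≤ys) (≤-reflexive tight)

Geodesic-between : ∀ {n} {u v z : V n} {ys} → Geodesic u ys v → z ∈ u ∷ ys →
                   diffCount u z + diffCount z v ≤ diffCount u v
Geodesic-between {u = u} {v} g (here refl) = ≤-reflexive (cong (_+ diffCount u v) (diffCount-refl u))
Geodesic-between {u = u} {v} {z} {w ∷ _} g@record { linked = u~w ∷ _ } (there z∈)
  with g′ , closer ← Geodesic-tail g = begin
    diffCount u z + diffCount z v                   ≤⟨ +-monoˡ-≤ (diffCount z v) (diffCount-triangle u w z) ⟩
    (diffCount u w + diffCount w z) + diffCount z v ≡⟨ cong (λ d → d + diffCount w z + diffCount z v) u~w ⟩
    suc (diffCount w z + diffCount z v)             ≤⟨ s≤s (Geodesic-between g′ z∈) ⟩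
    suc (diffCount w v)                             ≡⟨ closer ⟩
    diffCount u v                                   ∎
  where open ≤-Reasoning

Geodesic-∷ : ∀ {n} {w u v : V n} {ys} → Adj w u → diffCount w v ≡ suc (diffCount u v) →
             Geodesic u ys v → Geodesic w (u ∷ ys) v
Geodesic-∷ {w = w} {u} {v} w~u farther g = record
  { linked = w~u ∷ linked g
  ; unique = All.tabulate w≢ ∷ unique g
  ; ends   = ends g
  ; tight  = trans (cong suc (tight g)) (sym farther)
  }
  where
    w≢ : ∀ {z} → z ∈ u ∷ _ → w ≢ z
    w≢ {z} z∈ refl = 1+n≰n (begin
      suc (diffCount u v)            ≡⟨ farther ⟨
      diffCount z v                  ≤⟨ m≤n+m _ _ ⟩
      diffCount u z + diffCount z v  ≤⟨ Geodesic-between g z∈ ⟩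
      diffCount u v                  ∎)
      where open ≤-Reasoning

Isometric : ∀ {m n} → (V m → V n) → Set
Isometric φ = ∀ x y → diffCount (φ x) (φ y) ≡ diffCount x y

module _ {m n} {φ : V m → V n} (φ-isometric : Isometric φ) where

  Isometric⇒injective : ∀ {x y} → φ x ≡ φ y → x ≡ y
  Isometric⇒injective {x} {y} eq = diffCount≡0⇒≡ (begin
    diffCount x y          ≡⟨ φ-isometric x y ⟨
    diffCount (φ x) (φ y)  ≡⟨ cong (diffCount (φ x)) eq ⟨
    diffCount (φ x) (φ x)  ≡⟨ diffCount-refl (φ x) ⟩
    0                      ∎)
    where open ≡-Reasoning

  Geodesic-map : ∀ {u v ys} → Geodesic u ys v → Geodesic (φ u) (map φ ys) (φ v)
  Geodesic-map {u} {v} {ys} g = record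
    { linked = Linked.map⁺ (Linked.map (λ {x} {y} → trans (φ-isometric x y)) (linked g))
    ; unique = Unique.map⁺ Isometric⇒injective (unique g)
    ; ends   = trans (lastOf-map φ u ys) (cong φ (ends g))
    ; tight  = trans (length-map φ ys) (trans (tight g) (sym (φ-isometric u v)))
    }

  Geodesic-unmap : ∀ {u v ys} → Geodesic (φ u) (map φ ys) (φ v) → Geodesic u ys v
  Geodesic-unmap {u} {v} {ys} g = record
    { linked = Linked.map (λ {x} {y} → trans (sym (φ-isometric x y))) (Linked.map⁻ {xs = u ∷ ys} (linked g))
    ; unique = Unique.map⁻ {xs = u ∷ ys} (unique g)
    ; ends   = Isometric⇒injective (trans (sym (lastOf-map φ u ys)) (ends g))
    ; tight  = trans (sym (length-map φ ys)) (trans (tight g) (φ-isometric u v))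
    }

geodesic-exists : ∀ {n} (u v : V n) → ∃[ ys ] Geodesic u ys v
geodesic-exists [] [] = [] , record { linked = [-] ; unique = [] ∷ [] ; ends = refl ; tight = refl }
geodesic-exists (a ∷ u) (b ∷ v) with ys , g ← geodesic-exists u v | a ≟ b
... | yes refl = map (a ∷_) ys , Geodesic-map (diffCount-∷-same a) g
... | no a≢b   = (b ∷ u) ∷ map (b ∷_) ys , Geodesic-∷ step farther (Geodesic-map (diffCount-∷-same b) g)
  where
    step : Adj (a ∷ u) (b ∷ u)
    step = trans (diffCount-∷ a b u u) (cong₂ _+_ (bitDistance-≢ a≢b) (diffCount-refl u))
    farther : diffCount (a ∷ u) (b ∷ v) ≡ suc (diffCount (b ∷ u) (b ∷ v))
    farther = trans (diffCount-∷ a b u v) (cong₂ _+_ (bitDistance-≢ a≢b) (sym (diffCount-∷-same b u v)))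

module _ {n : ℕ} {u v : V n} where

  Geodesic⇒IsShortestPath : ∀ {ys} → Geodesic u ys v → IsShortestPath (u ∷ ys) u v
  Geodesic⇒IsShortestPath {ys} g = Geodesic⇒IsPath g , minimal
    where
      minimal : ∀ xs → IsPath xs u v → length (u ∷ ys) ≤ length xs
      minimal _ ((ws , refl) , (zs , eq) , walk , _) = s≤s (begin
        length ys                  ≡⟨ tight g ⟩
        diffCount u v              ≡⟨ cong (diffCount u) (∷ʳ⇒lastOf ws zs eq) ⟨
        diffCount u (lastOf u ws)  ≤⟨ walk-length≥diffCount u ws walk ⟩
        length ws                  ∎)
        where open ≤-Reasoning

  IsShortestPath⇒Geodesic : ∀ {xs} → IsShortestPath xs u v → ∃[ ys ] xs ≡ u ∷ ys × Geodesic u ys v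
  IsShortestPath⇒Geodesic (((ys , refl) , (zs , eq) , walk , unique) , minimal) =
    ys , refl , record { linked = walk ; unique = unique ; ends = ys→v ; tight = ≤-antisym ≤d d≤ }
    where
      ys→v : lastOf u ys ≡ v
      ys→v = ∷ʳ⇒lastOf ys zs eq
      ≤d : length ys ≤ diffCount u v
      ≤d with _ , g ← geodesic-exists u v =
        s≤s⁻¹ (≤-trans (minimal _ (Geodesic⇒IsPath g)) (≤-reflexive (cong suc (tight g))))
      d≤ : diffCount u v ≤ length ys
      d≤ = subst (λ w → diffCount u w ≤ length ys) ys→v (walk-length≥diffCount u ys walk)

  module _ {M : List (V n)} where

    Visible⇒Geodesic : Visible M u v → ∃[ ys ] Geodesic u ys v × IsFree M u v ys
    Visible⇒Geodesic (_ , shortest , free) with ys , refl , g ← IsShortestPath⇒Geodesic shortest =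
      ys , g , All.tail free

    Geodesic⇒Visible : ∀ {ys} → Geodesic u ys v → IsFree M u v ys → Visible M u v
    Geodesic⇒Visible g free = _ , Geodesic⇒IsShortestPath g , (λ _ → inj₁ refl) ∷ free

module _ {m n} {φ : V m → V n} (φ-isometric : Isometric φ) where

  private
    φ-injective = Isometric⇒injective {φ = φ} φ-isometric

  IsFree-map : ∀ {M u v ys} → IsFree M u v ys → IsFree (map φ M) (φ u) (φ v) (map φ ys)
  IsFree-map {M} free = All.map⁺ (All.map pull free)
    where
      pull : ∀ {z} → (z ∈ M → z ≡ _ ⊎ z ≡ _) → φ z ∈ map φ M → φ z ≡ _ ⊎ φ z ≡ _
      pull free-z φz∈ with z′ , z′∈ , eq ← ∈-map⁻ φ φz∈ =
        Sum.map (cong φ) (cong φ) (free-z (subst (_∈ M) (sym (φ-injective eq)) z′∈))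

  unique-map : ∀ {M} → Unique M → Unique (map φ M)
  unique-map = Unique.map⁺ φ-injective

  mutualVisibility-map : ∀ {M} → IsMutualVisibility M → IsMutualVisibility (map φ M)
  mutualVisibility-map {M} mv _ _ u∈ v∈
    with u , u∈M , refl ← ∈-map⁻ φ u∈ | v , v∈M , refl ← ∈-map⁻ φ v∈
    with ys , g , free ← Visible⇒Geodesic (mv u v u∈M v∈M) =
    Geodesic⇒Visible (Geodesic-map {φ = φ} φ-isometric g) (IsFree-map free)

-- Facets

facet : ∀ {n} → Bool → List (V (suc n)) → List (V n)
facet _     []                = []
facet true  ((true  ∷ x) ∷ M) = x ∷ facet true M
facet true  ((false ∷ _) ∷ M) = facet true M
facet false ((true  ∷ _) ∷ M) = facet false M
facet false ((false ∷ x) ∷ M) = x ∷ facet false M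

module _ {n : ℕ} where

  ∈-facet⁺ : ∀ b {M : List (V (suc n))} {z} → b ∷ z ∈ M → z ∈ facet b M
  ∈-facet⁺ true  {(true  ∷ _) ∷ _} (here refl) = here refl
  ∈-facet⁺ false {(false ∷ _) ∷ _} (here refl) = here refl
  ∈-facet⁺ true  {(true  ∷ _) ∷ _} (there z∈)  = there (∈-facet⁺ true z∈)
  ∈-facet⁺ true  {(false ∷ _) ∷ _} (there z∈)  = ∈-facet⁺ true z∈
  ∈-facet⁺ false {(true  ∷ _) ∷ _} (there z∈)  = ∈-facet⁺ false z∈
  ∈-facet⁺ false {(false ∷ _) ∷ _} (there z∈)  = there (∈-facet⁺ false z∈)

  ∈-facet⁻ : ∀ b (M : List (V (suc n))) {z} → z ∈ facet b M → b ∷ z ∈ M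
  ∈-facet⁻ true  ((true  ∷ _) ∷ _) (here refl) = here refl
  ∈-facet⁻ false ((false ∷ _) ∷ _) (here refl) = here refl
  ∈-facet⁻ true  ((true  ∷ _) ∷ M) (there z∈)  = there (∈-facet⁻ true M z∈)
  ∈-facet⁻ true  ((false ∷ _) ∷ M) z∈          = there (∈-facet⁻ true M z∈)
  ∈-facet⁻ false ((true  ∷ _) ∷ M) z∈          = there (∈-facet⁻ false M z∈)
  ∈-facet⁻ false ((false ∷ _) ∷ M) (there z∈)  = there (∈-facet⁻ false M z∈)

  ≢-facet : ∀ b {x} (M : List (V (suc n))) → All (b ∷ x ≢_) M → All (x ≢_) (facet b M)
  ≢-facet b M x∉ = All.tabulate (λ z∈ x≡z → All.lookup x∉ (∈-facet⁻ b M z∈) (cong (b ∷_) x≡z))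

  unique-facet : ∀ b {M : List (V (suc n))} → Unique M → Unique (facet b M)
  unique-facet b                      []         = []
  unique-facet true  {(true  ∷ _) ∷ M} (x∉ ∷ M!) = ≢-facet true M x∉ ∷ unique-facet true M!
  unique-facet true  {(false ∷ _) ∷ _} (_  ∷ M!) = unique-facet true M!
  unique-facet false {(true  ∷ _) ∷ _} (_  ∷ M!) = unique-facet false M!
  unique-facet false {(false ∷ _) ∷ M} (x∉ ∷ M!) = ≢-facet false M x∉ ∷ unique-facet false M!

  length-facets : ∀ (M : List (V (suc n))) → length M ≡ length (facet false M) + length (facet true M)
  length-facets []                = refl
  length-facets ((false ∷ _) ∷ M) = cong suc (length-facets M)
  length-facets ((true  ∷ _) ∷ M) = trans (cong suc (length-facets M)) (sym (+-suc _ _))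

  length-facets-by : ∀ b (M : List (V (suc n))) → length M ≡ length (facet b M) + length (facet (not b) M)
  length-facets-by false M = length-facets M
  length-facets-by true  M = trans (length-facets M) (+-comm (length (facet false M)) _)

private
  detour : ∀ {p q r} → r ≤ p + q → suc p + suc q ≤ r → ⊥
  detour {p} {q} {r} r≤ ≤r = 1+n≰n (begin
    suc (p + q)        ≤⟨ n≤1+n _ ⟩
    suc (suc (p + q))  ≡⟨ cong suc (+-suc p q) ⟨
    suc p + suc q      ≤⟨ ≤r ⟩
    r                  ≤⟨ r≤ ⟩
    p + q              ∎)
    where open ≤-Reasoning

  sameHead : ∀ {n} b (u v : V n) z → diffCount (b ∷ u) z + diffCount z (b ∷ v) ≤ diffCount (b ∷ u) (b ∷ v) →
             ∃[ z′ ] z ≡ b ∷ z′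
  sameHead true  u v (true  ∷ z) _  = z , refl
  sameHead false u v (false ∷ z) _  = z , refl
  sameHead true  u v (false ∷ z) le = ⊥-elim (detour (diffCount-triangle u z v) le)
  sameHead false u v (true  ∷ z) le = ⊥-elim (detour (diffCount-triangle u z v) le)

  All-∷⇒map : ∀ {n} b (zs : List (V (suc n))) → All (λ z → ∃[ z′ ] z ≡ b ∷ z′) zs →
              ∃[ ys ] zs ≡ map (b ∷_) ys
  All-∷⇒map b []       []                  = [] , refl
  All-∷⇒map b (_ ∷ zs) ((z′ , refl) ∷ heads) with ys , refl ← All-∷⇒map b zs heads = z′ ∷ ys , refl

Geodesic-facet : ∀ {n} b {u v : V n} {zs} → Geodesic (b ∷ u) zs (b ∷ v) → ∃[ ys ] zs ≡ map (b ∷_) ys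
Geodesic-facet b {u} {v} {zs} g =
  All-∷⇒map b zs (All.tabulate (λ {z} z∈ → sameHead b u v z (Geodesic-between g (there z∈))))

mutualVisibility-facet : ∀ {n} b {M : List (V (suc n))} → IsMutualVisibility M → IsMutualVisibility (facet b M)
mutualVisibility-facet b {M} mv u v u∈ v∈
  with zs , g , free ← Visible⇒Geodesic (mv (b ∷ u) (b ∷ v) (∈-facet⁻ b M u∈) (∈-facet⁻ b M v∈))
  with ys , refl ← Geodesic-facet b g =
  Geodesic⇒Visible (Geodesic-unmap {φ = b ∷_} (diffCount-∷-same b) g) (All.map pull (All.map⁻ free))
  where
    pull : ∀ {z} → (b ∷ z ∈ M → b ∷ z ≡ b ∷ u ⊎ b ∷ z ≡ b ∷ v) → z ∈ facet b M → z ≡ u ⊎ z ≡ v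
    pull free-z z∈ = Sum.map ∷-injectiveʳ ∷-injectiveʳ (free-z (∈-facet⁻ b M z∈))

relabel : ∀ {n} → Bool → (V n → V n) → V (suc n) → V (suc n)
relabel b f (a ∷ x) = (a xor b) ∷ f x

bitDistance-xor : ∀ a a′ b → bitDistance (a xor b) (a′ xor b) ≡ bitDistance a a′
bitDistance-xor true  true  true  = refl
bitDistance-xor true  true  false = refl
bitDistance-xor true  false true  = refl
bitDistance-xor true  false false = refl
bitDistance-xor false true  true  = refl
bitDistance-xor false true  false = refl
bitDistance-xor false false true  = refl
bitDistance-xor false false false = refl

relabel-isometric : ∀ {n} b {f : V n → V n} → Isometric f → Isometric (relabel b f)
relabel-isometric b {f} f-isometric (a ∷ x) (a′ ∷ y) = begin
  diffCount ((a xor b) ∷ f x) ((a′ xor b) ∷ f y)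
    ≡⟨ diffCount-∷ (a xor b) (a′ xor b) (f x) (f y) ⟩
  bitDistance (a xor b) (a′ xor b) + diffCount (f x) (f y)
    ≡⟨ cong₂ _+_ (bitDistance-xor a a′ b) (f-isometric x y) ⟩
  bitDistance a a′ + diffCount x y
    ≡⟨ diffCount-∷ a a′ x y ⟨
  diffCount (a ∷ x) (a′ ∷ y)
    ∎
  where open ≡-Reasoning

facet-relabel : ∀ {n} b c (f : V n → V n) M → facet c (map (relabel b f) M) ≡ map f (facet (c xor b) M)
facet-relabel b     c     f []                = refl
facet-relabel false false f ((false ∷ x) ∷ M) = cong (f x ∷_) (facet-relabel false false f M)
facet-relabel false false f ((true  ∷ _) ∷ M) = facet-relabel false false f M
facet-relabel false true  f ((false ∷ _) ∷ M) = facet-relabel false true f M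
facet-relabel false true  f ((true  ∷ x) ∷ M) = cong (f x ∷_) (facet-relabel false true f M)
facet-relabel true  false f ((false ∷ _) ∷ M) = facet-relabel true false f M
facet-relabel true  false f ((true  ∷ x) ∷ M) = cong (f x ∷_) (facet-relabel true false f M)
facet-relabel true  true  f ((false ∷ x) ∷ M) = cong (f x ∷_) (facet-relabel true true f M)
facet-relabel true  true  f ((true  ∷ _) ∷ M) = facet-relabel true true f M

Unique⇒length≤ : ∀ {A : Set} {xs ys : List A} → Unique xs → xs ⊆ ys → length xs ≤ length ys
Unique⇒length≤ []                         _     = z≤n
Unique⇒length≤ {xs = x ∷ xs} {ys} (x∉ ∷ xs!) x∷xs⊆ys = begin
  suc (length xs)
    ≤⟨ s≤s (Unique⇒length≤ xs! (λ z∈ → ∈-─ x∈ys (x∷xs⊆ys (there z∈)) (All.lookup x∉ z∈))) ⟩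
  suc (length (ys ─ x∈ys))
    ≡⟨ length-removeAt′ ys (index x∈ys) ⟨
  length ys
    ∎
  where
    open ≤-Reasoning
    x∈ys = x∷xs⊆ys (here refl)
    ∈-─ : ∀ {A : Set} {x z : A} {ys} (x∈ : x ∈ ys) → z ∈ ys → x ≢ z → z ∈ (ys ─ x∈)
    ∈-─ (here refl) (here refl) x≢z = contradiction refl x≢z
    ∈-─ (here refl) (there z∈)  _   = z∈
    ∈-─ (there _)   (here refl) _   = here refl
    ∈-─ (there x∈)  (there z∈)  x≢z = there (∈-─ x∈ z∈ x≢z)

-- A verified exhaustive search

_≟ᵥ_ : ∀ {n} → DecidableEquality (V n)
_≟ᵥ_ = ≡-dec _≟_

flipAt : ∀ {n} → Fin n → V n → V n
flipAt i x = updateAt x i not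

neighbours : ∀ {n} → V n → List (V n)
neighbours {n} u = map (λ i → flipAt i u) (allFin n)

module _ {n : ℕ} where

  infix 4 _==_ _∈ᵇ_ _⊆ᵇ_

  _==_ : V n → V n → Bool
  x == y = diffCount x y ≡ᵇ 0

  _∈ᵇ_ : V n → List (V n) → Bool
  x ∈ᵇ m = any (x ==_) m

  _⊆ᵇ_ : List (V n) → List (V n) → Bool
  xs ⊆ᵇ ys = all (_∈ᵇ ys) xs

  stepsTowards : V n → V n → List (V n)
  stepsTowards u v = filterᵇ (λ w → suc (diffCount w v) ≡ᵇ diffCount u v) (neighbours u)

  visibleWithin : ℕ → List (V n) → V n → V n → Bool
  visibleWithin zero    m u v = u == v
  visibleWithin (suc k) m u v = (u == v) ∨ any step (stepsTowards u v)
    where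
      step : V n → Bool
      step w = (w == v) ∨ (not (w ∈ᵇ m) ∧ visibleWithin k m w v)

allPairsᵇ : ∀ {A : Set} → (A → A → Bool) → List A → Bool
allPairsᵇ p []       = true
allPairsᵇ p (x ∷ xs) = all (p x) xs ∧ allPairsᵇ p xs

module _ {n : ℕ} where

  -- Adding b to cur can only hide one vertex of cur from another if b lies on a geodesic between them.
  extendsᵇ : List (V n) → V n → Bool
  extendsᵇ cur b =
    all (visibleWithin n m b) cur ∧ allPairsᵇ (λ x y → not (onGeodesic x y) ∨ visibleWithin n m x y) cur
    where
      m = b ∷ cur
      onGeodesic : V n → V n → Bool
      onGeodesic x y = (diffCount x b + diffCount b y) ≡ᵇ diffCount x y

  -- Runs through the sets L = cur ∪ S, S ⊆ rest, built by deciding the vertices of rest in turn,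
  -- abandoning a branch when the chosen vertices cannot be part of a mutual-visibility set or are
  -- too few to reach K; it succeeds when every L that is reached has fewer than K vertices or passes P.
  search : ℕ → (List (V n) → Bool) → List (V n) → List (V n) → Bool
  search K P cur []         = (length cur <ᵇ K) ∨ P cur
  search K P cur (b ∷ rest) =
    (length cur + suc (length rest) <ᵇ K) ∨
    ((not (extendsᵇ cur b) ∨ search K P (b ∷ cur) rest) ∧ search K P cur rest)

onFacet : ∀ {n} → Bool → List (V n) → List (V (suc n))
onFacet b = map (b ∷_)

vertices : (n : ℕ) → List (V n)
vertices zero    = [] ∷ []
vertices (suc n) = onFacet false (vertices n) ++ onFacet true (vertices n)

-- exchanges coordinates j and j + 1, and is the identity when j + 1 is out of range
swapAt : ∀ {n} → ℕ → V n → V n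
swapAt zero    (a ∷ b ∷ x) = b ∷ a ∷ x
swapAt zero    []          = []
swapAt zero    (a ∷ [])    = a ∷ []
swapAt (suc j) []          = []
swapAt (suc j) (a ∷ x)     = a ∷ swapAt j x

data Move (n : ℕ) : Set where
  swap : ℕ → Move n
  flip : Fin n → Move n

move : ∀ {n} → Move n → V n → V n
move (swap j) = swapAt j
move (flip i) = flipAt i

act : ∀ {n} → List (Move n) → V n → V n
act = foldr (λ g f → move g ∘ f) id

-- All 384 symmetries of Q₄: a permutation of the coordinates, written as a product of coset
-- representatives for S₁ ⊂ S₂ ⊂ S₃ ⊂ S₄ in adjacent transpositions, followed by bit flips.
symmetriesQ4 : List (List (Move 4))
symmetriesQ4 = foldr (cartesianProductWith _++_) ([] ∷ [])
  ( ([] ∷ (flip zero ∷ []) ∷ [])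
  ∷ ([] ∷ (flip (suc zero) ∷ []) ∷ [])
  ∷ ([] ∷ (flip (suc (suc zero)) ∷ []) ∷ [])
  ∷ ([] ∷ (flip (suc (suc (suc zero))) ∷ []) ∷ [])
  ∷ ([] ∷ (swap 0 ∷ []) ∷ [])
  ∷ ([] ∷ (swap 1 ∷ []) ∷ (swap 1 ∷ swap 0 ∷ []) ∷ [])
  ∷ ([] ∷ (swap 2 ∷ []) ∷ (swap 2 ∷ swap 1 ∷ []) ∷ (swap 2 ∷ swap 1 ∷ swap 0 ∷ []) ∷ [])
  ∷ [])

-- A mutual-visibility set of Q₄ of the maximum size 9, found by computer search.
maxMVQ4 : List (V 4)
maxMVQ4 =
    (false ∷ false ∷ true  ∷ true  ∷ [])
  ∷ (false ∷ true  ∷ false ∷ false ∷ [])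
  ∷ (false ∷ true  ∷ false ∷ true  ∷ [])
  ∷ (false ∷ true  ∷ true  ∷ false ∷ [])
  ∷ (true  ∷ false ∷ false ∷ false ∷ [])
  ∷ (true  ∷ false ∷ false ∷ true  ∷ [])
  ∷ (true  ∷ false ∷ true  ∷ false ∷ [])
  ∷ (true  ∷ true  ∷ false ∷ true  ∷ [])
  ∷ (true  ∷ true  ∷ true  ∷ false ∷ [])
  ∷ []

isMaxMVQ4Image : List (V 4) → Bool
isMaxMVQ4Image L = (length L ≡ᵇ 9) ∧ any (λ σ → maxMVQ4 ⊆ᵇ map (act σ) L) symmetriesQ4

Adj⇒flipAt : ∀ {n} (x : V n) {y} → Adj x y → ∃[ i ] y ≡ flipAt i x
Adj⇒flipAt []          {[]}        ()
Adj⇒flipAt (true ∷ x)  {true ∷ y}  x~y with i , refl ← Adj⇒flipAt x x~y = suc i , refl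
Adj⇒flipAt (false ∷ x) {false ∷ y} x~y with i , refl ← Adj⇒flipAt x x~y = suc i , refl
Adj⇒flipAt (true ∷ x)  {false ∷ y} x~y = zero , cong (false ∷_) (sym (diffCount≡0⇒≡ (suc-injective x~y)))
Adj⇒flipAt (false ∷ x) {true ∷ y}  x~y = zero , cong (true ∷_) (sym (diffCount≡0⇒≡ (suc-injective x~y)))

Adj⇒∈-neighbours : ∀ {n} {x y : V n} → Adj x y → y ∈ neighbours x
Adj⇒∈-neighbours {x = x} x~y with i , refl ← Adj⇒flipAt x x~y = ∈-map⁺ (λ j → flipAt j x) (∈-allFin i)

module _ {n : ℕ} where

  ==⇒≡ : ∀ {x y : V n} → T (x == y) → x ≡ y
  ==⇒≡ {x} {y} t = diffCount≡0⇒≡ (≡ᵇ⇒≡ (diffCount x y) 0 t)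

  ==-refl : ∀ (x : V n) → T (x == x)
  ==-refl x = ≡⇒≡ᵇ (diffCount x x) 0 (diffCount-refl x)

  ∈ᵇ⇒∈ : ∀ {x : V n} m → T (x ∈ᵇ m) → x ∈ m
  ∈ᵇ⇒∈ m t = Any.map ==⇒≡ (Any.any⁻ _ m t)

  ⊆ᵇ⇒⊆ : ∀ {xs ys : List (V n)} → T (xs ⊆ᵇ ys) → xs ⊆ ys
  ⊆ᵇ⇒⊆ {xs} {ys} t x∈ = ∈ᵇ⇒∈ ys (All.lookup (All.all⁺ _ xs t) x∈)

allPairsᵇ-complete : ∀ {A : Set} (p : A → A → Bool) {xs} → (∀ {x y} → x ∈ xs → y ∈ xs → T (p x y)) →
                     T (allPairsᵇ p xs)
allPairsᵇ-complete p {[]}     _      = _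
allPairsᵇ-complete p {x ∷ xs} p-holds = Equivalence.from T-∧
  ( All.all⁻ (p x) (All.tabulate (λ y∈ → p-holds (here refl) (there y∈)))
  , allPairsᵇ-complete p (λ x∈ y∈ → p-holds (there x∈) (there y∈)) )

module _ {n : ℕ} (m : List (V n)) where

  stepsTowards-complete : ∀ {u v w : V n} → Adj u w → suc (diffCount w v) ≡ diffCount u v →
                          w ∈ stepsTowards u v
  stepsTowards-complete u~w closer = ∈-filter⁺ (T? ∘ _) (Adj⇒∈-neighbours u~w) (≡⇒≡ᵇ _ _ closer)

  visibleWithin-refl : ∀ k {u v} → u ≡ v → T (visibleWithin k m u v)
  visibleWithin-refl zero    {u} refl = ==-refl u
  visibleWithin-refl (suc k) {u} refl = Equivalence.from (T-∨ {u == u}) (inj₁ (==-refl u))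

  visibleWithin-complete : ∀ k {u v ys} → Geodesic u ys v → All (λ z → z ∈ m → z ≡ v) ys →
                           diffCount u v ≤ k → T (visibleWithin k m u v)
  visibleWithin-complete k       {ys = []}    g _ _ = visibleWithin-refl k (Geodesic.ends g)
  visibleWithin-complete zero    {ys = _ ∷ _} g _ d≤0 with () ← trans (Geodesic.tight g) (n≤0⇒n≡0 d≤0)
  visibleWithin-complete (suc k) {u} {v} {w ∷ ys} g@record { linked = u~w ∷ _ } (free-w ∷ free) d≤
    with g′ , closer ← Geodesic-tail g =
    Equivalence.from (T-∨ {u == v})
      (inj₂ (Any.any⁺ _ (Any.map (λ { refl → step-w }) (stepsTowards-complete u~w closer))))
    where
      step-w : T ((w == v) ∨ (not (w ∈ᵇ m) ∧ visibleWithin k m w v))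
      step-w with w ≟ᵥ v | w ∈ᵇ m in w∈ᵇm
      ... | yes refl | _     = Equivalence.from (T-∨ {v == v}) (inj₁ (==-refl v))
      ... | no w≢v   | true  = contradiction (free-w (∈ᵇ⇒∈ m (subst T (sym w∈ᵇm) _))) w≢v
      ... | no w≢v   | false = Equivalence.from (T-∨ {w == v})
                                  (inj₂ (visibleWithin-complete k g′ free (s≤s⁻¹ (≤-trans (≤-reflexive closer) d≤))))

private
  T-not-∨ : ∀ {a b} → T a → T (not a ∨ b) → T b
  T-not-∨ {true} _ t = t

module _ {n : ℕ} {M : List (V n)} (M-mv : IsMutualVisibility M) where

  visibleWithin-mutual : ∀ {m x y} → m ⊆ M → x ∈ M → y ∈ M → T (visibleWithin n m x y)
  visibleWithin-mutual {m} {x} {y} m⊆M x∈ y∈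
    with ys , g@record { unique = x∉ys ∷ _ } , free ← Visible⇒Geodesic (M-mv x y x∈ y∈) =
    visibleWithin-complete m n g (All.zipWith avoids (x∉ys , free)) (diffCount≤dim x y)
    where
      avoids : ∀ {z} → x ≢ z × (z ∈ M → z ≡ x ⊎ z ≡ y) → z ∈ m → z ≡ y
      avoids (x≢z , free-z) z∈m with free-z (m⊆M z∈m)
      ... | inj₁ refl = contradiction refl x≢z
      ... | inj₂ z≡y  = z≡y

  extendsᵇ-complete : ∀ {cur b} → b ∷ cur ⊆ M → T (extendsᵇ cur b)
  extendsᵇ-complete {cur} {b} b∷cur⊆M = Equivalence.from T-∧
    ( All.all⁻ _ (All.tabulate (λ x∈ → visible (here refl) (there x∈)))
    , allPairsᵇ-complete _ (λ x∈ y∈ → Equivalence.from T-∨ (inj₂ (visible (there x∈) (there y∈)))) )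
    where
      visible : ∀ {x y} → x ∈ b ∷ cur → y ∈ b ∷ cur → T (visibleWithin n (b ∷ cur) x y)
      visible x∈ y∈ = visibleWithin-mutual b∷cur⊆M (b∷cur⊆M x∈) (b∷cur⊆M y∈)

record SearchLeaf {n} (M cur rest L : List (V n)) : Set where
  field
    leaf⊆M      : L ⊆ M
    cur⊆leaf    : cur ⊆ L
    M∩rest⊆leaf : ∀ {z} → z ∈ M → z ∈ rest → z ∈ L

module _ {n : ℕ} {M : List (V n)} where

  open DecMembership (_≟ᵥ_ {n}) using (_∈?_)
  open SearchLeaf

  SearchLeaf-complete : ∀ {cur} rest → cur ⊆ M → SearchLeaf M cur rest (cur ++ filter (_∈? M) rest)
  SearchLeaf-complete {cur} rest cur⊆M = record
    { leaf⊆M      = λ z∈ → [ cur⊆M , proj₂ ∘ ∈-filter⁻ (_∈? M) {xs = rest} ]′ (∈-++⁻ cur z∈)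
    ; cur⊆leaf    = ∈-++⁺ˡ
    ; M∩rest⊆leaf = λ z∈M z∈rest → ∈-++⁺ʳ cur (∈-filter⁺ (_∈? M) z∈rest z∈M)
    }

  length-complete : ∀ cur rest → length (cur ++ filter (_∈? M) rest) ≤ length cur + length rest
  length-complete cur rest =
    ≤-trans (≤-reflexive (length-++ cur)) (+-monoʳ-≤ (length cur) (length-filter (_∈? M) rest))

  SearchLeaf-take : ∀ {b cur rest L} → SearchLeaf M (b ∷ cur) rest L → SearchLeaf M cur (b ∷ rest) L
  SearchLeaf-take leaf = record
    { leaf⊆M      = leaf⊆M leaf
    ; cur⊆leaf    = cur⊆leaf leaf ∘ there
    ; M∩rest⊆leaf = λ { _   (here refl) → cur⊆leaf leaf (here refl)
                      ; z∈M (there z∈)  → M∩rest⊆leaf leaf z∈M z∈ }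
    }

  SearchLeaf-skip : ∀ {b cur rest L} → b ∉ M → SearchLeaf M cur rest L → SearchLeaf M cur (b ∷ rest) L
  SearchLeaf-skip b∉M leaf = record
    { leaf⊆M      = leaf⊆M leaf
    ; cur⊆leaf    = cur⊆leaf leaf
    ; M∩rest⊆leaf = λ { z∈M (here refl) → contradiction z∈M b∉M
                      ; z∈M (there z∈)  → M∩rest⊆leaf leaf z∈M z∈ }
    }

  -- The branch that takes exactly the vertices of M is never pruned, by extendsᵇ-complete.
  search-sound : IsMutualVisibility M → ∀ K (P : List (V n) → Bool) (cur rest : List (V n)) →
                 search K P cur rest ≡ true → cur ⊆ M →
                 ∃[ L ] SearchLeaf M cur rest L × (length L < K ⊎ T (P L))
  search-sound M-mv K P cur [] t cur⊆M =
    cur , record { leaf⊆M = cur⊆M ; cur⊆leaf = id ; M∩rest⊆leaf = λ _ () } ,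
    map₁ (<ᵇ⇒< _ _) (Equivalence.to T-∨ (Equivalence.from T-≡ t))
  search-sound M-mv K P cur (b ∷ rest) t cur⊆M with Equivalence.to T-∨ (Equivalence.from T-≡ t)
  ... | inj₁ few =
    _ , SearchLeaf-complete (b ∷ rest) cur⊆M ,
    inj₁ (≤-<-trans (length-complete cur (b ∷ rest)) (<ᵇ⇒< _ _ few))
  ... | inj₂ t′ with Equivalence.to T-∧ t′ | b ∈? M
  ...   | with-b , _ | yes b∈M =
    let b∷cur⊆M = ∈-∷⁺ʳ b∈M cur⊆M
        L , leaf , result = search-sound M-mv K P (b ∷ cur) rest
                              (Equivalence.to T-≡ (T-not-∨ (extendsᵇ-complete M-mv b∷cur⊆M) with-b)) b∷cur⊆M
    in L , SearchLeaf-take leaf , result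
  ...   | _ , without-b | no b∉M =
    let L , leaf , result = search-sound M-mv K P cur rest (Equivalence.to T-≡ without-b) cur⊆M
    in L , SearchLeaf-skip b∉M leaf , result

flipAt-isometric : ∀ {n} (i : Fin n) → Isometric (flipAt i)
flipAt-isometric zero    (true  ∷ x) (true  ∷ y) = refl
flipAt-isometric zero    (true  ∷ x) (false ∷ y) = refl
flipAt-isometric zero    (false ∷ x) (true  ∷ y) = refl
flipAt-isometric zero    (false ∷ x) (false ∷ y) = refl
flipAt-isometric (suc i) (a ∷ x)     (b ∷ y)     = diffCount-∷-cong a b (flipAt-isometric i x y)

swapAt-isometric : ∀ {n} j → Isometric (swapAt {n} j)
swapAt-isometric zero    []           []           = refl
swapAt-isometric zero    (a ∷ [])     (b ∷ [])     = refl
swapAt-isometric zero    (a ∷ a′ ∷ x) (b ∷ b′ ∷ y) = begin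
  diffCount (a′ ∷ a ∷ x) (b′ ∷ b ∷ y)
    ≡⟨ trans (diffCount-∷ a′ b′ _ _) (cong (bitDistance a′ b′ +_) (diffCount-∷ a b x y)) ⟩
  bitDistance a′ b′ + (bitDistance a b + diffCount x y)
    ≡⟨ x∙yz≈y∙xz +-commutativeSemigroup (bitDistance a′ b′) (bitDistance a b) (diffCount x y) ⟩
  bitDistance a b + (bitDistance a′ b′ + diffCount x y)
    ≡⟨ trans (diffCount-∷ a b _ _) (cong (bitDistance a b +_) (diffCount-∷ a′ b′ x y)) ⟨
  diffCount (a ∷ a′ ∷ x) (b ∷ b′ ∷ y)
    ∎
  where open ≡-Reasoning
swapAt-isometric (suc j) []      []      = refl
swapAt-isometric (suc j) (a ∷ x) (b ∷ y) = diffCount-∷-cong a b (swapAt-isometric j x y)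

move-isometric : ∀ {n} (g : Move n) → Isometric (move g)
move-isometric (swap j) = swapAt-isometric j
move-isometric (flip i) = flipAt-isometric i

act-isometric : ∀ {n} (σ : List (Move n)) → Isometric (act σ)
act-isometric []      x y = refl
act-isometric (g ∷ σ) x y = trans (move-isometric g (act σ x) (act σ y)) (act-isometric σ x y)

maxMVQ4-unique : Unique maxMVQ4
maxMVQ4-unique = toWitness {a? = unique? _≟ᵥ_ maxMVQ4} _

vertices-complete : ∀ {n} (x : V n) → x ∈ vertices n
vertices-complete []          = here refl
vertices-complete {suc n} (false ∷ x) = ∈-++⁺ˡ (∈-map⁺ (false ∷_) (vertices-complete x))
vertices-complete {suc n} (true ∷ x)  =
  ∈-++⁺ʳ (onFacet false (vertices n)) (∈-map⁺ (true ∷_) (vertices-complete x))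

-- The cubes Q₄ and Q₅

search-Q4 : search 9 isMaxMVQ4Image [] (vertices 4) ≡ true
search-Q4 = refl

-- The dimension is given so that this type is syntactically the premise of search-sound at
-- M : List (V 5); otherwise checking that application would run the search again.
search-Q5 : search {5} 17 (const false) (onFacet false maxMVQ4) (onFacet true (vertices 4)) ≡ true
search-Q5 = refl

SmallOrMaxMVQ4Image : List (V 4) → Set
SmallOrMaxMVQ4Image M = length M ≤ 8 ⊎ (length M ≤ 9 × ∃[ σ ] maxMVQ4 ⊆ map (act σ) M)

mvQ4-classification : ∀ (M : List (V 4)) → Unique M → IsMutualVisibility M → SmallOrMaxMVQ4Image M
mvQ4-classification M M! M-mv = classify (search-sound M-mv 9 isMaxMVQ4Image [] (vertices 4) search-Q4 (λ ()))
  where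
    M≤leaf : ∀ {L} → SearchLeaf M [] (vertices 4) L → length M ≤ length L
    M≤leaf leaf = Unique⇒length≤ M! (λ z∈ → SearchLeaf.M∩rest⊆leaf leaf z∈ (vertices-complete _))
    -- a helper rather than `with`, which would normalise isMaxMVQ4Image L into a huge term
    classify : ∃[ L ] SearchLeaf M [] (vertices 4) L × (length L < 9 ⊎ T (isMaxMVQ4Image L)) →
               SmallOrMaxMVQ4Image M
    classify (L , leaf , inj₁ L<9)   = inj₁ (s≤s⁻¹ (≤-trans (s≤s (M≤leaf leaf)) L<9))
    classify (L , leaf , inj₂ image) =
      let L≡9 , some-σ = Equivalence.to (T-∧ {length L ≡ᵇ 9}) image
          σ , max⊆σL   = Any.satisfied (Any.any⁻ (λ σ → maxMVQ4 ⊆ᵇ map (act σ) L) symmetriesQ4 some-σ)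
      in inj₂ ( ≤-trans (M≤leaf leaf) (≤-reflexive (≡ᵇ⇒≡ _ 9 L≡9))
              , σ , ⊆-trans (⊆ᵇ⇒⊆ max⊆σL) (Subset.map⁺ (act σ) (SearchLeaf.leaf⊆M leaf)) )

MVBound : ℕ → ℕ → Set
MVBound n k = ∀ (M : List (V n)) → Unique M → IsMutualVisibility M → length M ≤ k

mvBound-Q4 : MVBound 4 9
mvBound-Q4 M M! M-mv = [ (λ M≤8 → ≤-trans M≤8 (n≤1+n 8)) , proj₁ ]′ (mvQ4-classification M M! M-mv)

mvBound-facet : ∀ {n k} → MVBound n k → ∀ b (M : List (V (suc n))) → Unique M → IsMutualVisibility M →
                length (facet b M) ≤ k
mvBound-facet bound b M M! M-mv = bound (facet b M) (unique-facet b M!) (mutualVisibility-facet b M-mv)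

mvBound-suc : ∀ {n k} → MVBound n k → MVBound (suc n) (k + k)
mvBound-suc {k = k} bound M M! M-mv = begin
  length M                                        ≡⟨ length-facets M ⟩
  length (facet false M) + length (facet true M)  ≤⟨ +-mono-≤ (mvBound-facet bound false M M! M-mv)
                                                              (mvBound-facet bound true M M! M-mv) ⟩
  k + k                                           ∎
  where open ≤-Reasoning

maxMVQ4-opposite-facet : ∀ (M : List (V 5)) → Unique M → IsMutualVisibility M → onFacet false maxMVQ4 ⊆ M →
                         length (facet true M) ≤ 7
maxMVQ4-opposite-facet M M! M-mv max⊆M =
  bound (search-sound M-mv 17 (const false) (onFacet false maxMVQ4) (onFacet true (vertices 4)) search-Q5 max⊆M)
  where
    bound : ∃[ L ] SearchLeaf M (onFacet false maxMVQ4) (onFacet true (vertices 4)) L ×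
                   (length L < 17 ⊎ T (const false L)) →
            length (facet true M) ≤ 7
    bound (L , leaf , inj₁ L<17) = +-cancelˡ-≤ 9 _ _ (begin
      9 + length (facet true M)                       ≤⟨ +-mono-≤ 9≤L₀ M₁≤L₁ ⟩
      length (facet false L) + length (facet true L)  ≡⟨ length-facets L ⟨
      length L                                        ≤⟨ s≤s⁻¹ L<17 ⟩
      16                                              ∎)
      where
        open ≤-Reasoning
        open SearchLeaf leaf
        9≤L₀ : 9 ≤ length (facet false L)
        9≤L₀ = Unique⇒length≤ maxMVQ4-unique (λ a∈ → ∈-facet⁺ false (cur⊆leaf (∈-map⁺ (false ∷_) a∈)))
        M₁≤L₁ : length (facet true M) ≤ length (facet true L)
        M₁≤L₁ = Unique⇒length≤ (unique-facet true M!) λ {z} z∈ →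
          ∈-facet⁺ true (M∩rest⊆leaf (∈-facet⁻ true M z∈) (∈-map⁺ (true ∷_) (vertices-complete z)))

large-facet-opposite : ∀ b (M : List (V 5)) → Unique M → IsMutualVisibility M → 9 ≤ length (facet b M) →
                       length (facet (not b) M) ≤ 7
large-facet-opposite b M M! M-mv 9≤M_b =
  opposite (mvQ4-classification (facet b M) (unique-facet b M!) (mutualVisibility-facet b M-mv))
  where
    opposite : SmallOrMaxMVQ4Image (facet b M) → length (facet (not b) M) ≤ 7
    opposite (inj₁ M_b≤8)              = contradiction (≤-trans 9≤M_b M_b≤8) 1+n≰n
    opposite (inj₂ (_ , σ , max⊆σM_b)) = begin
      length (facet (not b) M)                ≡⟨ length-map (act σ) (facet (not b) M) ⟨
      length (map (act σ) (facet (not b) M))  ≡⟨ cong length (facet-relabel b true (act σ) M) ⟨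
      length (facet true M′)                  ≤⟨ maxMVQ4-opposite-facet M′ (unique-map ψ-isometric M!)
                                                   (mutualVisibility-map ψ-isometric M-mv) max⊆M′ ⟩
      7                                       ∎
      where
        open ≤-Reasoning
        ψ-isometric = relabel-isometric b (act-isometric σ)
        M′ = map (relabel b (act σ)) M
        max⊆M′ : onFacet false maxMVQ4 ⊆ M′
        max⊆M′ a∈ with a , a∈max , refl ← ∈-map⁻ (false ∷_) a∈ =
          ∈-facet⁻ false M′ (subst (a ∈_) (sym (facet-relabel b false (act σ) M)) (max⊆σM_b a∈max))

mvBound-Q5 : MVBound 5 16
mvBound-Q5 M M! M-mv = ≤-trans (≤-reflexive (length-facets M)) (facets≤16 (9 ≤? length M₀) (9 ≤? length M₁))
  where
    M₀ = facet false M
    M₁ = facet true M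
    facets≤16 : Dec (9 ≤ length M₀) → Dec (9 ≤ length M₁) → length M₀ + length M₁ ≤ 16
    facets≤16 (yes 9≤M₀) _          =
      +-mono-≤ (mvBound-facet mvBound-Q4 false M M! M-mv) (large-facet-opposite false M M! M-mv 9≤M₀)
    facets≤16 (no _)     (yes 9≤M₁) =
      +-mono-≤ (large-facet-opposite true M M! M-mv 9≤M₁) (mvBound-facet mvBound-Q4 true M M! M-mv)
    facets≤16 (no 9≰M₀)  (no 9≰M₁)  = +-mono-≤ (s≤s⁻¹ (≰⇒> 9≰M₀)) (s≤s⁻¹ (≰⇒> 9≰M₁))

mvBound : ∀ m → MVBound (5 + m) (2 ^ (4 + m))
mvBound zero    = mvBound-Q5
mvBound (suc m) = subst (MVBound (6 + m)) (cong (2 ^ (4 + m) +_) (sym (+-identityʳ _))) (mvBound-suc (mvBound m))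

-- Stars

∃-notInImage : ∀ {k m} → k < m → (p : Fin k → Fin m) → ∃[ j ] ∀ i → p i ≢ j
∃-notInImage {k} {m} k<m p = map₂ (λ unhit i pi≡j → unhit (i , pi≡j))
  (¬∀⟶∃¬ m (λ j → ∃[ i ] p i ≡ j) (λ j → any? (λ i → p i ≟ᶠ j)) not-all-hit)
  where
    not-all-hit : ¬ (∀ j → ∃[ i ] p i ≡ j)
    not-all-hit hit = <⇒≱ k<m (injective⇒≤ {f = λ j → proj₁ (hit j)} λ {j} {j′} eq →
      trans (sym (proj₂ (hit j))) (trans (cong p eq) (proj₂ (hit j′))))

Fin-injective⇒surjective : ∀ {n} (p : Fin n → Fin n) → Injective _≡_ _≡_ p → ∀ j → ∃[ i ] p i ≡ j
Fin-injective⇒surjective {n} p p-injective j with any? (λ i → p i ≟ᶠ j)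
... | yes hit = hit
... | no unhit = contradiction (injective⇒≤ p′-injective) 1+n≰n
  where
    p′ : Fin (suc n) → Fin n
    p′ zero    = j
    p′ (suc i) = p i
    p′-injective : Injective _≡_ _≡_ p′
    p′-injective {zero}  {zero}  _  = refl
    p′-injective {zero}  {suc i} eq = contradiction (i , sym eq) unhit
    p′-injective {suc i} {zero}  eq = contradiction (i , eq) unhit
    p′-injective {suc i} {suc i′} eq = cong suc (p-injective eq)

Adj-irrefl : ∀ {n} {x : V n} → ¬ Adj x x
Adj-irrefl {x = x} x~x with () ← trans (sym (diffCount-refl x)) x~x

record Star {n} (M : List (V n)) : Set where
  field
    centre              : V n
    neighbour           : Fin 4 → V n
    centre∈M            : centre ∈ M
    neighbour∈M         : ∀ i → neighbour i ∈ M
    neighbour-injective : Injective _≡_ _≡_ neighbour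
    centre~neighbour    : ∀ i → Adj centre (neighbour i)

InducedStar14⇒Star : ∀ {n} {M Y : List (V n)} → Y ⊆ M → InducedStar14 Y → Star M
InducedStar14⇒Star Y⊆M (c , a , Y⇔ , a-injective , _ , c~a , _) = record
  { centre              = c
  ; neighbour           = a
  ; centre∈M            = Y⊆M (Equivalence.from (Y⇔ c) (inj₁ refl))
  ; neighbour∈M         = λ i → Y⊆M (Equivalence.from (Y⇔ (a i)) (inj₂ (i , refl)))
  ; neighbour-injective = a-injective
  ; centre~neighbour    = c~a
  }

mutualVisibility-closedNeighbourhood : ∀ {n} {M : List (V n)} {c z} → IsMutualVisibility M → c ∈ M →
  (∀ {w} → Adj c w → w ∈ M) → z ∈ M → z ≡ c ⊎ Adj c z
mutualVisibility-closedNeighbourhood {c = c} {z} M-mv c∈M closed z∈M with z ≟ᵥ c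
... | yes z≡c = inj₁ z≡c
... | no z≢c with Visible⇒Geodesic (M-mv c z c∈M z∈M)
...   | [] , g , _ = contradiction (sym (Geodesic.ends g)) z≢c
...   | w ∷ _ , record { linked = c~w ∷ _ } , free-w ∷ _ with free-w (closed c~w)
...     | inj₁ refl = contradiction c~w (Adj-irrefl {x = c})
...     | inj₂ refl = inj₂ c~w

Adj-exhausted : ∀ {n} (c : V n) {w} (a : Fin n → V n) → Injective _≡_ _≡_ a → (∀ i → Adj c (a i)) →
                Adj c w → ∃[ i ] w ≡ a i
Adj-exhausted c a a-injective c~a c~w =
  let q , w≡ = Adj⇒flipAt c c~w
      i , pᵢ≡q = Fin-injective⇒surjective position position-injective q
  in i , trans w≡ (trans (cong (λ j → flipAt j c) (sym pᵢ≡q)) (sym (flipped i)))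
  where
    position : Fin _ → Fin _
    position i = proj₁ (Adj⇒flipAt c (c~a i))
    flipped : ∀ i → a i ≡ flipAt (position i) c
    flipped i = proj₂ (Adj⇒flipAt c (c~a i))
    position-injective : Injective _≡_ _≡_ position
    position-injective {i} {i′} eq =
      a-injective (trans (flipped i) (trans (cong (λ j → flipAt j c) eq) (sym (flipped i′))))

-- stated as length M + 2 ≤ k to avoid truncated subtraction
StarMVBound : ℕ → ℕ → Set
StarMVBound n k = ∀ (M : List (V n)) → Unique M → IsMutualVisibility M → Star M → length M + 2 ≤ k

starBound-Q4 : StarMVBound 4 7
starBound-Q4 M M! M-mv star = +-monoˡ-≤ 2 (Unique⇒length≤ M! M⊆star)
  where
    open Star star
    exhausted : ∀ {w} → Adj centre w → ∃[ i ] w ≡ neighbour i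
    exhausted = Adj-exhausted centre neighbour neighbour-injective centre~neighbour
    closed : ∀ {w} → Adj centre w → w ∈ M
    closed c~w = let i , w≡ = exhausted c~w in subst (_∈ M) (sym w≡) (neighbour∈M i)
    M⊆star : M ⊆ centre ∷ map neighbour (allFin 4)
    M⊆star z∈M with mutualVisibility-closedNeighbourhood M-mv centre∈M closed z∈M
    ... | inj₁ refl = here refl
    ... | inj₂ c~z  = let i , z≡ = exhausted c~z in
                      there (subst (_∈ _) (sym z≡) (∈-map⁺ neighbour (∈-allFin i)))

moveToFront : ∀ {n} → Fin (suc n) → V (suc n) → V (suc n)
moveToFront j x = lookup x j ∷ removeAt x j

diffCount-removeAt : ∀ {n} (j : Fin (suc n)) (x y : V (suc n)) →
  diffCount x y ≡ bitDistance (lookup x j) (lookup y j) + diffCount (removeAt x j) (removeAt y j)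
diffCount-removeAt zero    (a ∷ x)         (b ∷ y)         = diffCount-∷ a b x y
diffCount-removeAt (suc j) (a ∷ x@(_ ∷ _)) (b ∷ y@(_ ∷ _)) = begin
  diffCount (a ∷ x) (b ∷ y)
    ≡⟨ trans (diffCount-∷ a b x y) (cong (bitDistance a b +_) (diffCount-removeAt j x y)) ⟩
  bitDistance a b + (bitDistance xⱼ yⱼ + diffCount x′ y′)
    ≡⟨ x∙yz≈y∙xz +-commutativeSemigroup (bitDistance a b) (bitDistance xⱼ yⱼ) (diffCount x′ y′) ⟩
  bitDistance xⱼ yⱼ + (bitDistance a b + diffCount x′ y′)
    ≡⟨ cong (bitDistance xⱼ yⱼ +_) (diffCount-∷ a b x′ y′) ⟨
  bitDistance xⱼ yⱼ + diffCount (a ∷ x′) (b ∷ y′)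
    ∎
  where
    open ≡-Reasoning
    xⱼ = lookup x j
    yⱼ = lookup y j
    x′ = removeAt x j
    y′ = removeAt y j

moveToFront-isometric : ∀ {n} (j : Fin (suc n)) → Isometric (moveToFront j)
moveToFront-isometric j x y =
  trans (diffCount-∷ (lookup x j) (lookup y j) (removeAt x j) (removeAt y j)) (sym (diffCount-removeAt j x y))

-- Some coordinate j is changed by none of the four edges of the star; moving j to the front puts
-- the star into a facet.
Star-facet : ∀ {n} {M : List (V (suc n))} → 4 ≤ n → Star M →
             ∃[ φ ] Isometric φ × ∃[ b ] Star (facet b (map φ M))
Star-facet {n} {M} 4≤n star = φ , φ-isometric , lookup centre j , record
  { centre              = removeAt centre j
  ; neighbour           = λ i → removeAt (neighbour i) j
  ; centre∈M            = ∈-facet⁺ _ (∈-map⁺ φ centre∈M)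
  ; neighbour∈M         = λ i → ∈-facet⁺ _ (subst (_∈ map φ M) (moved i) (∈-map⁺ φ (neighbour∈M i)))
  ; neighbour-injective = λ {i} {i′} eq → neighbour-injective (Isometric⇒injective {φ = φ} φ-isometric
                            (trans (moved i) (trans (cong (_ ∷_) eq) (sym (moved i′)))))
  ; centre~neighbour    = λ i → begin
      diffCount (removeAt centre j) (removeAt (neighbour i) j)   ≡⟨ diffCount-∷-same (lookup centre j) _ _ ⟨
      diffCount (φ centre) (lookup centre j ∷ _)                 ≡⟨ cong (diffCount (φ centre)) (moved i) ⟨
      diffCount (φ centre) (φ (neighbour i))                     ≡⟨ φ-isometric centre (neighbour i) ⟩
      diffCount centre (neighbour i)                             ≡⟨ centre~neighbour i ⟩
      1                                                          ∎
  }
  where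
    open Star star
    open ≡-Reasoning
    position : Fin 4 → Fin (suc n)
    position i = proj₁ (Adj⇒flipAt centre (centre~neighbour i))
    j : Fin (suc n)
    j = proj₁ (∃-notInImage (s≤s 4≤n) position)
    φ = moveToFront j
    φ-isometric = moveToFront-isometric j
    moved : ∀ i → φ (neighbour i) ≡ lookup centre j ∷ removeAt (neighbour i) j
    moved i = cong (_∷ removeAt (neighbour i) j) (begin
      lookup (neighbour i) j
        ≡⟨ cong (λ x → lookup x j) (proj₂ (Adj⇒flipAt centre (centre~neighbour i))) ⟩
      lookup (flipAt (position i) centre) j
        ≡⟨ lookup∘updateAt′ j (position i) (proj₂ (∃-notInImage (s≤s 4≤n) position) i ∘ sym) centre ⟩
      lookup centre j
        ∎)

starBound-suc : ∀ {n s k} → 4 ≤ n → StarMVBound n s → MVBound n k → StarMVBound (suc n) (s + k)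
starBound-suc {s = s} {k} 4≤n star-bound bound M M! M-mv star
  with φ , φ-isometric , b , star′ ← Star-facet 4≤n star = begin
  length M + 2
    ≡⟨ cong (_+ 2) (trans (sym (length-map φ M)) (length-facets-by b M′)) ⟩
  length (facet b M′) + length (facet (not b) M′) + 2
    ≡⟨ xy∙z≈xz∙y +-commutativeSemigroup (length (facet b M′)) _ 2 ⟩
  (length (facet b M′) + 2) + length (facet (not b) M′)
    ≤⟨ +-mono-≤ (star-bound (facet b M′) (unique-facet b M′!) (mutualVisibility-facet b M′-mv) star′)
                (mvBound-facet bound (not b) M′ M′! M′-mv) ⟩
  s + k
    ∎
  where
    open ≤-Reasoning
    M′ = map φ M
    M′! = unique-map φ-isometric M!
    M′-mv = mutualVisibility-map φ-isometric M-mv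

starBound : ∀ m → StarMVBound (5 + m) (2 ^ (4 + m))
starBound zero    = starBound-suc ≤-refl starBound-Q4 mvBound-Q4
starBound (suc m) = subst (StarMVBound (6 + m)) (cong (2 ^ (4 + m) +_) (sym (+-identityʳ _)))
                          (starBound-suc (m≤m+n 4 (suc m)) (starBound m) (mvBound m))

proposition3p5 : (h : ℕ) → 6 ≤ h → (M Y : List (V h)) → Unique M →
    IsMutualVisibility M → Y ⊆ M → InducedStar14 Y →
    length M ≤ 2 ^ (h ∸ 1) ∸ 2
proposition3p5 h 6≤h M Y M! M-mv Y⊆M star with k , refl ← m≤n⇒∃[o]m+o≡n 6≤h =
  m+n≤o⇒m≤o∸n (length M) (starBound (suc k) M M! M-mv (InducedStar14⇒Star Y⊆M star))
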